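{- Let $G=(V,E)$ be a directed graph with $V=\{v_1,\dots,v_n\}$, without self-loops and in which every vertex has at least one outgoing edge. Construct the game graph $\Gamma$ whose vertex set consists of a start vertex $s$ and four copies $V^1,V^2,V^3,V^4$ of $V$, with $v_{ji}\in V^j$ the copy of $v_i$; edges: $(s,v_{1i})$ for all $i$; for $1\le j\le 3$, $(v_{ji},v_{(j+1)l})$ iff $(v_i,v_l)\in E$; and $(v_{4i},s)$ for all $i$; all vertices are player-2 vertices (there are no player-1 vertices). Let $\mathcal{T}=(T_1,\dots,T_n)$ with $T_i=(V^1\setminus\{v_{1i}\})\cup(V^4\setminus\{v_{4i}\})$. Then $G$ contains a triangle (vertices $x,y,z$ with $(x,y),(y,z),(z,x)\in E$) if and only if player 1 has no policy from $s$ that is winning for the objective $\mathrm{Seq}(\mathcal{T})$.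
   Context: In a game graph, vertices are partitioned into player-1 and player-2 vertices; player $i$ chooses successors at its vertices according to a policy. A play is an infinite sequence of vertices following edges. A player-1 policy is winning from $s$ for objective $\phi$ if for every player-2 policy the resulting play lies in $\phi$. $\mathrm{Seq}(\mathcal{T})$ for $\mathcal{T}=(T_1,\dots,T_n)$ is the set of plays $v_0v_1\dots$ for which there exist indices $j_1\le\dots\le j_n$ with $v_{j_i}\in T_i$ for all $i$. -}

module Defs where

open import Data.Nat using (ℕ; zero; suc)
open import Data.Fin using (Fin) renaming (_≤_ to _≤ᶠ_)
import Data.Nat as N
open import Data.Bool using (Bool; true; false)
open import Data.List using (List; []; _∷_; _++_)
open import Data.Product using (Σ; ∃; _×_; _,_; proj₁; proj₂)
open import Data.Sum using (_⊎_)
open import Relation.Binary.PropositionalEquality using (_≡_; _≢_; refl)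

data Player : Set where
  p1 p2 : Player

record GameGraph : Set₁ where
  field
    Vtx   : Set
    Edge  : Vtx → Vtx → Set
    owner : Vtx → Player

module _ (Γ : GameGraph) where
  open GameGraph Γ

  -- A policy for player p: given the history of the play so far (the
  -- vertices strictly before the current one) and the current vertex v,
  -- owned by p, it chooses a successor of v.
  Policy : Player → Set
  Policy p = (h : List Vtx) (v : Vtx) → owner v ≡ p → Σ Vtx (Edge v)

  Play : Set
  Play = ℕ → Vtx

  Objective : Set₁
  Objective = Play → Set

  private
    move : Policy p1 → Policy p2 → List Vtx → (v : Vtx) → (o : Player) → owner v ≡ o → Vtx
    move σ τ h v p1 eq = proj₁ (σ h v eq)
    move σ τ h v p2 eq = proj₁ (τ h v eq)

    -- (history before the k-th vertex , k-th vertex)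
    run : Policy p1 → Policy p2 → Vtx → ℕ → List Vtx × Vtx
    run σ τ s zero = [] , s
    run σ τ s (suc k) with run σ τ s k
    ... | h , v = (h ++ (v ∷ [])) , move σ τ h v (owner v) refl

  outcome : Policy p1 → Policy p2 → Vtx → Play
  outcome σ τ s k = proj₂ (run σ τ s k)

  Seq : {n : ℕ} → (Fin n → Vtx → Set) → Objective
  Seq {n} T ρ = Σ (Fin n → ℕ) λ j →
    ((i i' : Fin n) → i ≤ᶠ i' → j i N.≤ j i') × ((i : Fin n) → T i (ρ (j i)))

  Winning : Policy p1 → Vtx → Objective → Set
  Winning σ s φ = (τ : Policy p2) → φ (outcome σ τ s)

DiGraph : ℕ → Set
DiGraph n = Fin n → Fin n → Bool

module _ {n : ℕ} (G : DiGraph n) where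

  E : Fin n → Fin n → Set
  E i l = G i l ≡ true

  NoSelfLoops : Set
  NoSelfLoops = (i : Fin n) → G i i ≡ false

  OutEdges : Set
  OutEdges = (i : Fin n) → ∃ λ l → E i l

  HasTriangle : Set
  HasTriangle = ∃ λ x → ∃ λ y → ∃ λ z → E x y × E y z × E z x

  data ΓV : Set where
    s  : ΓV
    v1 v2 v3 v4 : Fin n → ΓV

  data ΓE : ΓV → ΓV → Set where
    e-s1 : (i : Fin n) → ΓE s (v1 i)
    e-12 : (i l : Fin n) → E i l → ΓE (v1 i) (v2 l)
    e-23 : (i l : Fin n) → E i l → ΓE (v2 i) (v3 l)
    e-34 : (i l : Fin n) → E i l → ΓE (v3 i) (v4 l)
    e-4s : (i : Fin n) → ΓE (v4 i) s

  Γ : GameGraph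
  Γ = record { Vtx = ΓV ; Edge = ΓE ; owner = λ _ → p2 }

  T : Fin n → ΓV → Set
  T i v = (∃ λ l → v ≡ v1 l × l ≢ i) ⊎ (∃ λ l → v ≡ v4 l × l ≢ i)

-- Without a triangle, every round s → v1 a → v2 b → v3 c → v4 d → s of a play has a ≢ d.
-- The vertex v1 a lies in every T i with i ≢ a and v4 d in every T i with i ≢ d, so greedily
-- the targets below a are met at v1 a, those from a up to d at v4 d, and the next round
-- continues from d; when d < a (or a is already passed) the targets run out within the round.
-- With a triangle x → y → z → x, player 2 can instead cycle through v1 x and v4 x forever and
-- never enter T x.
module Submission where

open import Defs
open import Data.Nat using (ℕ; zero; suc; _+_; _≤_; _<_; z≤n; _<?_)
open import Data.Nat.Properties
  using (≤-refl; ≤-trans; ≤-<-trans; <-≤-trans; ≤-reflexive; <-irrefl; ≮⇒≥; <-cmp;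
         n≤1+n; m≤n+m; +-suc; +-identityʳ; +-monoʳ-≤)
open import Data.Fin using (Fin; toℕ; _≟_)
open import Data.Fin.Properties using (toℕ<n; toℕ-injective; any?; <⇒≢)
open import Data.Bool using (true)
import Data.Bool as Bool
open import Data.Product using (∃; Σ; _×_; _,_; proj₁; proj₂)
open import Data.Sum using (inj₁; inj₂)
open import Data.Empty using (⊥; ⊥-elim)
open import Relation.Nullary using (¬_; Dec; yes; no; contradiction)
open import Relation.Nullary.Decidable using (_×-dec_)
open import Relation.Binary using (tri<; tri≈; tri>)
open import Relation.Binary.PropositionalEquality using (_≡_; _≢_; refl; sym; subst)
open import Function.Bundles using (_⇔_; mk⇔)

module SeqCovering (Γ : GameGraph) {n : ℕ} (T : Fin n → GameGraph.Vtx Γ → Set) (ρ : Play Γ) where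

  SeqFrom : ℕ → ℕ → Set
  SeqFrom p t = Σ (Fin n → ℕ) λ J →
      (∀ i i' → p ≤ toℕ i → toℕ i ≤ toℕ i' → J i ≤ J i')
    × (∀ i → p ≤ toℕ i → T i (ρ (J i)))
    × (∀ i → p ≤ toℕ i → t ≤ J i)

  seqFrom⇒Seq : ∀ {t} → SeqFrom 0 t → Seq Γ T ρ
  seqFrom⇒Seq (J , mono , hit , _) = J , (λ i i' → mono i i' z≤n) , (λ i → hit i z≤n)

  seqFrom-beyond : ∀ {p t} → n ≤ p → SeqFrom p t
  seqFrom-beyond {p} {t} n≤p = (λ _ → t) , (λ i _ p≤i _ → ⊥-elim (beyond i p≤i))
                             , (λ i p≤i → ⊥-elim (beyond i p≤i)) , (λ _ _ → ≤-refl)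
    where
    beyond : ∀ i → p ≤ toℕ i → ⊥
    beyond i p≤i = <-irrefl refl (≤-<-trans (≤-trans n≤p p≤i) (toℕ<n i))

  seqFrom-block : ∀ {p q c t t'} → (∀ i → p ≤ toℕ i → toℕ i < q → T i (ρ c)) →
                  t ≤ c → c ≤ t' → SeqFrom q t' → SeqFrom p t
  seqFrom-block {p} {q} {c} {t} {t'} hitBlock t≤c c≤t' (R , monoR , hitR , lowR) =
    J , mono , hit , low
    where
    J : Fin n → ℕ
    J i with toℕ i <? q
    ... | yes _ = c
    ... | no _  = R i
    mono : ∀ i i' → p ≤ toℕ i → toℕ i ≤ toℕ i' → J i ≤ J i'
    mono i i' _ i≤i' with toℕ i <? q | toℕ i' <? q
    ... | yes _   | yes _    = ≤-refl
    ... | yes _   | no i'≮q  = ≤-trans c≤t' (lowR i' (≮⇒≥ i'≮q))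
    ... | no i≮q  | yes i'<q = contradiction (≤-<-trans i≤i' i'<q) i≮q
    ... | no i≮q  | no _     = monoR i i' (≮⇒≥ i≮q) i≤i'
    hit : ∀ i → p ≤ toℕ i → T i (ρ (J i))
    hit i p≤i with toℕ i <? q
    ... | yes i<q = hitBlock i p≤i i<q
    ... | no i≮q  = hitR i (≮⇒≥ i≮q)
    low : ∀ i → p ≤ toℕ i → t ≤ J i
    low i _ with toℕ i <? q
    ... | yes _   = t≤c
    ... | no i≮q  = ≤-trans t≤c (≤-trans c≤t' (lowR i (≮⇒≥ i≮q)))

  seqFrom-at : ∀ {p c t} → (∀ i → p ≤ toℕ i → T i (ρ c)) → t ≤ c → SeqFrom p t
  seqFrom-at hitAll t≤c =
    seqFrom-block (λ i p≤i _ → hitAll i p≤i) t≤c ≤-refl (seqFrom-beyond ≤-refl)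

  Avoids : ℕ → Fin n → Set
  Avoids c a = ∀ i → i ≢ a → T i (ρ c)

  module Rounds (Start : ℕ → Set) where

    record Round (t : ℕ) : Set where
      field
        early late next     : ℕ
        t≤early             : t ≤ early
        early≤late          : early ≤ late
        late≤next           : late ≤ next
        skipEarly skipLate  : Fin n
        skipEarly≢skipLate  : skipEarly ≢ skipLate
        avoidsEarly         : Avoids early skipEarly
        avoidsLate          : Avoids late skipLate
        startNext           : Start next
    open Round

    module _ (round : ∀ {t} → Start t → Round t) where

      -- Each recursive call raises p, so fuel n suffices.
      seqFrom-rounds : ∀ fuel p {t} → n ≤ fuel + p → Start t → SeqFrom p t
      seqFrom-rounds zero p bound _ = seqFrom-beyond bound
      seqFrom-rounds (suc fuel) p bound start with round start
      ... | r with toℕ (skipEarly r) <? p | <-cmp (toℕ (skipEarly r)) (toℕ (skipLate r))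
      ... | yes a<p | _ =
        seqFrom-at (λ i p≤i → avoidsEarly r i (λ i≡a → <⇒≢ (<-≤-trans a<p p≤i) (sym i≡a)))
                   (t≤early r)
      ... | no _ | tri≈ _ a≡d _ = ⊥-elim (skipEarly≢skipLate r (toℕ-injective a≡d))
      ... | no _ | tri> _ _ d<a =
        seqFrom-block (λ i _ i<a → avoidsEarly r i (<⇒≢ i<a)) (t≤early r) (early≤late r)
          (seqFrom-at (λ i a≤i → avoidsLate r i (λ i≡d → <⇒≢ (<-≤-trans d<a a≤i) (sym i≡d)))
                      ≤-refl)
      ... | no a≮p | tri< a<d _ _ =
        seqFrom-block (λ i _ i<a → avoidsEarly r i (<⇒≢ i<a)) (t≤early r) (early≤late r)
          (seqFrom-block (λ i _ i<d → avoidsLate r i (<⇒≢ i<d)) ≤-refl (late≤next r)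
            (seqFrom-rounds fuel (toℕ (skipLate r)) bound' (startNext r)))
        where
        bound' : n ≤ fuel + toℕ (skipLate r)
        bound' = ≤-trans bound (≤-trans (≤-reflexive (sym (+-suc fuel p)))
                   (+-monoʳ-≤ fuel (≤-<-trans (≮⇒≥ a≮p) a<d)))

      seq-rounds : ∀ {t} → Start t → Seq Γ T ρ
      seq-rounds start = seqFrom⇒Seq (seqFrom-rounds n 0 (≤-reflexive (sym (+-identityʳ n))) start)

module _ {n : ℕ} (G : DiGraph n) where

  hasTriangle? : Dec (HasTriangle G)
  hasTriangle? = any? λ x → any? λ y → any? λ z →
    (G x y Bool.≟ true) ×-dec (G y z Bool.≟ true) ×-dec (G z x Bool.≟ true)

  play-edge : ∀ σ τ {v} k → ΓE G (outcome (Γ G) σ τ v k) (outcome (Γ G) σ τ v (suc k))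
  play-edge σ τ k = proj₂ (τ _ _ refl)

  noMoves : Policy (Γ G) p1
  noMoves _ _ ()

  T-v1 : ∀ {i a} → i ≢ a → T G i (v1 a)
  T-v1 {a = a} i≢a = inj₁ (a , refl , λ a≡i → i≢a (sym a≡i))

  T-v4 : ∀ {i d} → i ≢ d → T G i (v4 d)
  T-v4 {d = d} i≢d = inj₂ (d , refl , λ d≡i → i≢d (sym d≡i))

  module _ (ρ : ℕ → ΓV G) (edge : ∀ k → ΓE G (ρ k) (ρ (suc k))) where

    s-step : ∀ {t} → ρ t ≡ s → ∃ λ a → ρ (suc t) ≡ v1 a
    s-step {t} eq with ρ t | ρ (suc t) | edge t
    s-step refl | .s | .(v1 i) | e-s1 i = i , refl

    v1-step : ∀ {t a} → ρ t ≡ v1 a → ∃ λ b → ρ (suc t) ≡ v2 b × E G a b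
    v1-step {t} eq with ρ t | ρ (suc t) | edge t
    v1-step refl | .(v1 i) | .(v2 l) | e-12 i l e = l , refl , e

    v2-step : ∀ {t a} → ρ t ≡ v2 a → ∃ λ b → ρ (suc t) ≡ v3 b × E G a b
    v2-step {t} eq with ρ t | ρ (suc t) | edge t
    v2-step refl | .(v2 i) | .(v3 l) | e-23 i l e = l , refl , e

    v3-step : ∀ {t a} → ρ t ≡ v3 a → ∃ λ b → ρ (suc t) ≡ v4 b × E G a b
    v3-step {t} eq with ρ t | ρ (suc t) | edge t
    v3-step refl | .(v3 i) | .(v4 l) | e-34 i l e = l , refl , e

    v4-step : ∀ {t a} → ρ t ≡ v4 a → ρ (suc t) ≡ s
    v4-step {t} eq with ρ t | ρ (suc t) | edge t
    v4-step refl | .(v4 i) | .s | e-4s i = refl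

    open SeqCovering (Γ G) (T G) ρ
    open Rounds (λ t → ρ t ≡ s)

    round : ¬ HasTriangle G → ∀ {t} → ρ t ≡ s → Round t
    round noTriangle {t} atS =
      let a , at1 = s-step atS
          b , at2 , ab = v1-step at1
          c , at3 , bc = v2-step at2
          d , at4 , cd = v3-step at3
      in record
        { early = 1 + t ; late = 4 + t ; next = 5 + t
        ; t≤early = n≤1+n t ; early≤late = m≤n+m (1 + t) 3 ; late≤next = n≤1+n (4 + t)
        ; skipEarly = a ; skipLate = d
        ; skipEarly≢skipLate = λ a≡d → noTriangle (a , b , c , ab , bc , subst (E G c) (sym a≡d) cd)
        ; avoidsEarly = λ i i≢a → subst (T G i) (sym at1) (T-v1 i≢a)
        ; avoidsLate = λ i i≢d → subst (T G i) (sym at4) (T-v4 i≢d)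
        ; startNext = v4-step at4
        }

    noTriangle⇒Seq : ¬ HasTriangle G → ρ 0 ≡ s → Seq (Γ G) (T G) ρ
    noTriangle⇒Seq noTriangle = seq-rounds (round noTriangle)

  module TriangleCycle (out : OutEdges G) {x y z : Fin n}
                       (xy : E G x y) (yz : E G y z) (zx : E G z x) where

    towards : ∀ {u v} → E G u v → ∀ i → ∃ (E G i)
    towards {u} {v} uv i with i ≟ u
    ... | yes refl = v , uv
    ... | no _     = out i

    towards-self : ∀ {u v} (uv : E G u v) → proj₁ (towards uv u) ≡ v
    towards-self {u} uv with u ≟ u
    ... | yes refl = refl
    ... | no u≢u   = ⊥-elim (u≢u refl)

    step : (w : ΓV G) → Σ (ΓV G) (ΓE G w)
    step s      = v1 x , e-s1 x
    step (v1 i) = let l , e = towards xy i in v2 l , e-12 i l e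
    step (v2 i) = let l , e = towards yz i in v3 l , e-23 i l e
    step (v3 i) = let l , e = towards zx i in v4 l , e-34 i l e
    step (v4 i) = s , e-4s i

    τ : Policy (Γ G) p2
    τ _ w _ = step w

    data OnCycle : ΓV G → Set where
      at-s  : OnCycle s
      at-v1 : OnCycle (v1 x)
      at-v2 : OnCycle (v2 y)
      at-v3 : OnCycle (v3 z)
      at-v4 : OnCycle (v4 x)

    step-OnCycle : ∀ {w} → OnCycle w → OnCycle (proj₁ (step w))
    step-OnCycle at-s  = at-v1
    step-OnCycle at-v1 rewrite towards-self xy = at-v2
    step-OnCycle at-v2 rewrite towards-self yz = at-v3
    step-OnCycle at-v3 rewrite towards-self zx = at-v4
    step-OnCycle at-v4 = at-s

    outcome-OnCycle : ∀ σ k → OnCycle (outcome (Γ G) σ τ s k)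
    outcome-OnCycle σ zero    = at-s
    outcome-OnCycle σ (suc k) = step-OnCycle (outcome-OnCycle σ k)

    OnCycle-∉T : ∀ {w} → OnCycle w → ¬ T G x w
    OnCycle-∉T at-v1 (inj₁ (_ , refl , x≢x)) = x≢x refl
    OnCycle-∉T at-v4 (inj₂ (_ , refl , x≢x)) = x≢x refl

    ¬Seq : ∀ σ → ¬ Seq (Γ G) (T G) (outcome (Γ G) σ τ s)
    ¬Seq σ (J , _ , hit) = OnCycle-∉T (outcome-OnCycle σ (J x)) (hit x)

mainTheorem14 : {n : ℕ} (G : DiGraph n) → NoSelfLoops G → OutEdges G →
    (HasTriangle G ⇔ (¬ ∃ λ σ → Winning (Γ G) σ (s {G = G}) (Seq (Γ G) (T G))))
mainTheorem14 G _ out = mk⇔ triangle⇒noWin noWin⇒triangle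
  where
  triangle⇒noWin : HasTriangle G → ¬ ∃ λ σ → Winning (Γ G) σ s (Seq (Γ G) (T G))
  triangle⇒noWin (x , y , z , xy , yz , zx) (σ , win) = ¬Seq σ (win τ)
    where open TriangleCycle G out xy yz zx

  noWin⇒triangle : (¬ ∃ λ σ → Winning (Γ G) σ s (Seq (Γ G) (T G))) → HasTriangle G
  noWin⇒triangle noWin with hasTriangle? G
  ... | yes triangle  = triangle
  ... | no noTriangle = ⊥-elim (noWin (noMoves G , λ τ →
          noTriangle⇒Seq G _ (play-edge G (noMoves G) τ) noTriangle refl))
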